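{- Let $\mathcal{R}$ be a rewrite system on a set $\mathcal{F}$ of symbols and $t\in\mathcal{T}(\mathcal{F},\mathcal{X}\cup\mathcal{X}_A)$. For every ground normalized substitution $\alpha$ and every rewrite chain $\alpha t\rightarrow_{p_1,l_1\rightarrow r_1}t_1\rightarrow_{p_2,l_2\rightarrow r_2}t_2\rightarrow\cdots\rightarrow_{p_n,l_n\rightarrow r_n}t_n$ starting from $\alpha t$, and for every $k$ with $1\le k\le n$, the (defined) symbol of $t_k$ at any redex position of $t_k$ is either a symbol occurring in $t$ or a symbol occurring in one of the $r_i$, $i\in[1..k]$.
   Context: $\mathcal{X}$ is a set of variables and $\mathcal{X}_A$ a set of "abstraction variables" disjoint from $\mathcal{X}$; rules $l\rightarrow r$ of $\mathcal{R}$ satisfy $\mathrm{Var}(r)\subseteq\mathrm{Var}(l)$. A ground substitution $\alpha$ is normalized if $\alpha x$ is an $\mathcal{R}$-irreducible ground term for every variable $x$ of its domain (here covering all variables of $t$). A redex position of a term $u$ is a position $p$ such that $u|_p$ is an instance of the left-hand side of a rule of $\mathcal{R}$. A defined symbol is a symbol occurring at the top of the left-hand side of some rule. Rewrite steps are standard rewriting steps with $\mathcal{R}$. -}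

module Defs where

open import Data.Nat using (ℕ; zero; suc; _≤_; _<_)
open import Data.Fin using (Fin; toℕ)
open import Data.Vec using (Vec; []; _∷_; lookup; _[_]≔_)
open import Data.List using (List; []; _∷_)
open import Data.Maybe using (Maybe; just; nothing)
open import Data.Empty using (⊥)
open import Data.Sum using (_⊎_)
open import Data.Product using (Σ; ∃; _×_)
open import Relation.Binary.PropositionalEquality using (_≡_)
open import Relation.Nullary using (¬_)

-- Term rewriting over a ranked signature (Sym, arity), rule variables X,
-- abstraction variables XA (disjointness is built in by using X ⊎ XA).
module Rewriting (Sym : Set) (arity : Sym → ℕ) (X XA : Set) where

  data Term (V : Set) : Set where
    var : V → Term V
    app : (f : Sym) → Vec (Term V) (arity f) → Term V

  GTerm : Set
  GTerm = Term ⊥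

  TermXA : Set
  TermXA = Term (X ⊎ XA)

  mutual
    _⟨_⟩ : {V W : Set} → (V → Term W) → Term V → Term W
    σ ⟨ var x ⟩ = σ x
    σ ⟨ app f ts ⟩ = app f (σ ⟨ ts ⟩*)

    _⟨_⟩* : {V W : Set} {n : ℕ} → (V → Term W) → Vec (Term V) n → Vec (Term W) n
    σ ⟨ [] ⟩* = []
    σ ⟨ t ∷ ts ⟩* = (σ ⟨ t ⟩) ∷ (σ ⟨ ts ⟩*)

  data _∈vars_ {V : Set} (x : V) : Term V → Set where
    here  : x ∈vars var x
    there : ∀ {f ts} (i : Fin (arity f)) → x ∈vars lookup ts i → x ∈vars app f ts

  data _occursIn_ {V : Set} (g : Sym) : Term V → Set where
    here  : ∀ {ts} → g occursIn app g ts
    there : ∀ {f ts} (i : Fin (arity f)) → g occursIn lookup ts i → g occursIn app f ts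

  -- positions: sequences of argument indices (0-based)
  Pos : Set
  Pos = List ℕ

  data _at_is_ {V : Set} : Term V → Pos → Term V → Set where
    root : ∀ {t} → t at [] is t
    arg  : ∀ {f ts p u} (i : Fin (arity f)) → lookup ts i at p is u → app f ts at (toℕ i ∷ p) is u

  headSym : {V : Set} → Term V → Maybe Sym
  headSym (var _) = nothing
  headSym (app f _) = just f

  record Rule : Set where
    field
      lhs : Term X
      rhs : Term X
      varsOK : ∀ x → x ∈vars rhs → x ∈vars lhs
  open Rule public

  RS : Set₁
  RS = Rule → Set

  data Step (ρ : Rule) : Pos → GTerm → GTerm → Set where
    root   : (σ : X → GTerm) → Step ρ [] (σ ⟨ lhs ρ ⟩) (σ ⟨ rhs ρ ⟩)
    inside : ∀ {f ts p u} (i : Fin (arity f)) → Step ρ p (lookup ts i) u →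
             Step ρ (toℕ i ∷ p) (app f ts) (app f (ts [ i ]≔ u))

  Irreducible : RS → GTerm → Set
  Irreducible R u = ∀ ρ p u′ → R ρ → ¬ Step ρ p u u′

  Normalized : RS → (X ⊎ XA → GTerm) → TermXA → Set
  Normalized R α t = ∀ x → x ∈vars t → Irreducible R (α x)

  RedexPos : RS → GTerm → Pos → Set
  RedexPos R u p = Σ GTerm λ v → (u at p is v) ×
                   Σ Rule λ ρ → R ρ × Σ (X → GTerm) λ σ → v ≡ σ ⟨ lhs ρ ⟩

  -- a rewrite chain α t = s 0 → s 1 → … → s n, the i-th step (1 ≤ i ≤ n)
  -- going from s (i-1) to s i at position ps i with rule ρs i ∈ R
  IsChain : RS → GTerm → (n : ℕ) → (ℕ → GTerm) → (ℕ → Pos) → (ℕ → Rule) → Set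
  IsChain R t₀ n s ps ρs =
    (s 0 ≡ t₀) ×
    (∀ i → i < n → R (ρs (suc i)) × Step (ρs (suc i)) (ps (suc i)) (s i) (s (suc i)))

{-# OPTIONS --safe #-}
module Submission where

-- Every term s k of the chain is a context built from symbols of t and of
-- rhs (ρs 1), …, rhs (ρs k), filled with R-normal forms (initially the α x).
-- No step can happen inside a normal form, so a step rewrites inside the
-- context; the contractum consists of symbols of the rule's right-hand side
-- over subterms bound to its variables, and these sit below the redex, so they
-- have the same shape. A redex is not a normal form, hence its head symbol
-- lies in the context.

open import Defs
open import Data.Nat using (ℕ; zero; suc; _≤_; s≤s; z≤n)
open import Data.Nat.Properties using (≤-refl; m≤n⇒m≤1+n; <⇒≤)
open import Data.Maybe using (just)
open import Data.Sum using (_⊎_; inj₁; inj₂)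
open import Data.Product using (Σ; _×_; _,_)
open import Data.Fin using (Fin; toℕ; _≟_) renaming (zero to fzero; suc to fsuc)
open import Data.Fin.Properties using (toℕ-injective)
open import Data.Vec using (Vec; _∷_; lookup; _[_]≔_)
open import Data.Vec.Properties using (lookup∘update; lookup∘update′)
open import Data.List using ([]; _∷_)
open import Data.List.Properties using (∷-injective)
open import Data.Empty using (⊥-elim)
open import Relation.Nullary using (yes; no)
open import Relation.Binary.PropositionalEquality using (_≡_; refl; sym; subst)

module RewriteChainCaps (Sym : Set) (arity : Sym → ℕ) (X XA : Set) where
  open Rewriting Sym arity X XA

  at-unique : ∀ {V} {u : Term V} {q v w} → u at q is v → u at q is w → v ≡ w
  at-unique = go refl
    where
    -- The positions are generalised apart: Agda cannot unify toℕ i with toℕ j.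
    go : ∀ {V} {u : Term V} {q q′ v w} → q ≡ q′ → u at q is v → u at q′ is w → v ≡ w
    go _ root root = refl
    go eq (arg i a) (arg j b) with ∷-injective eq
    ... | i≡j , p≡p′ with toℕ-injective i≡j
    ...   | refl = go p≡p′ a b

  lookup-⟨⟩* : ∀ {V W n} (σ : V → Term W) (ts : Vec (Term V) n) (i : Fin n) →
               lookup (σ ⟨ ts ⟩*) i ≡ σ ⟨ lookup ts i ⟩
  lookup-⟨⟩* σ (t ∷ ts) fzero = refl
  lookup-⟨⟩* σ (t ∷ ts) (fsuc i) = lookup-⟨⟩* σ ts i

  module _ (R : RS) where

    irreducible-lookup : ∀ {f ts} → Irreducible R (app f ts) →
                         (i : Fin (arity f)) → Irreducible R (lookup ts i)
    irreducible-lookup irr i ρ p u′ ρ∈R st = irr ρ (toℕ i ∷ p) _ ρ∈R (inside i st)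

    data CappedBy (P : Sym → Set) : GTerm → Set where
      normal : ∀ {u} → Irreducible R u → CappedBy P u
      node   : ∀ {f ts} → P f → (∀ i → CappedBy P (lookup ts i)) → CappedBy P (app f ts)

    cappedBy-mono : ∀ {P Q : Sym → Set} {u} → (∀ {f} → P f → Q f) →
                    CappedBy P u → CappedBy Q u
    cappedBy-mono P⊆Q (normal irr) = normal irr
    cappedBy-mono P⊆Q (node Pf cs) = node (P⊆Q Pf) (λ i → cappedBy-mono P⊆Q (cs i))

    cappedBy-lookup : ∀ {P f ts} → CappedBy P (app f ts) → ∀ i → CappedBy P (lookup ts i)
    cappedBy-lookup (normal irr) i = normal (irreducible-lookup irr i)
    cappedBy-lookup (node _ cs) i = cs i

    cappedBy-at : ∀ {P u q v} → CappedBy P u → u at q is v → CappedBy P v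
    cappedBy-at c root = c
    cappedBy-at c (arg i a) = cappedBy-at (cappedBy-lookup c i) a

    cappedBy-var : ∀ {P V} (σ : V → GTerm) (l : Term V) {x} →
                   CappedBy P (σ ⟨ l ⟩) → x ∈vars l → CappedBy P (σ x)
    cappedBy-var σ (var x) c here = c
    cappedBy-var {P} σ (app f ts) c (there i x∈) =
      cappedBy-var σ (lookup ts i) (subst (CappedBy P) (lookup-⟨⟩* σ ts i) (cappedBy-lookup c i)) x∈

    mutual
      cappedBy-⟨⟩ : ∀ {P V} (σ : V → GTerm) (r : Term V) →
                    (∀ {g} → g occursIn r → P g) →
                    (∀ {x} → x ∈vars r → CappedBy P (σ x)) → CappedBy P (σ ⟨ r ⟩)
      cappedBy-⟨⟩ σ (var x) symsP varsC = varsC here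
      cappedBy-⟨⟩ σ (app g ts) symsP varsC =
        node (symsP here)
             (cappedBy-⟨⟩* σ ts (λ i g∈ → symsP (there i g∈)) (λ i x∈ → varsC (there i x∈)))

      cappedBy-⟨⟩* : ∀ {P V n} (σ : V → GTerm) (ts : Vec (Term V) n) →
                     (∀ i {g} → g occursIn lookup ts i → P g) →
                     (∀ i {x} → x ∈vars lookup ts i → CappedBy P (σ x)) →
                     ∀ i → CappedBy P (lookup (σ ⟨ ts ⟩*) i)
      cappedBy-⟨⟩* σ (t ∷ ts) symsP varsC fzero = cappedBy-⟨⟩ σ t (symsP fzero) (varsC fzero)
      cappedBy-⟨⟩* σ (t ∷ ts) symsP varsC (fsuc i) =
        cappedBy-⟨⟩* σ ts (λ j → symsP (fsuc j)) (λ j → varsC (fsuc j)) i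

    cappedBy-step : ∀ {P ρ p u u′} → R ρ → (∀ {g} → g occursIn rhs ρ → P g) →
                    CappedBy P u → Step ρ p u u′ → CappedBy P u′
    cappedBy-step {ρ = ρ} ρ∈R rhsP c (root σ) =
      cappedBy-⟨⟩ σ (rhs ρ) rhsP (λ x∈ → cappedBy-var σ (lhs ρ) c (varsOK ρ _ x∈))
    cappedBy-step {ρ = ρ} ρ∈R rhsP (normal irr) st = ⊥-elim (irr ρ _ _ ρ∈R st)
    cappedBy-step {P} ρ∈R rhsP (node {ts = ts} Pf cs) (inside {u = u} i st) = node Pf cs′
      where
      cs′ : ∀ j → CappedBy P (lookup (ts [ i ]≔ u) j)
      cs′ j with i ≟ j
      ... | yes refl = subst (CappedBy P) (sym (lookup∘update i ts u)) (cappedBy-step ρ∈R rhsP (cs i) st)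
      ... | no i≢j = subst (CappedBy P) (sym (lookup∘update′ (λ j≡i → i≢j (sym j≡i)) ts u)) (cs j)

    redex-head-in-cap : ∀ {P u q v f} → CappedBy P u → u at q is v → RedexPos R u q →
                        headSym v ≡ just f → P f
    redex-head-in-cap c u∣q (v′ , u∣q′ , ρ , ρ∈R , σ , v′≡lσ) head
      with at-unique u∣q′ u∣q
    ... | refl = head-in-cap (cappedBy-at c u∣q) v′≡lσ head
      where
      head-in-cap : ∀ {P v f} → CappedBy P v → v ≡ σ ⟨ lhs ρ ⟩ → headSym v ≡ just f → P f
      head-in-cap (normal irr) refl _ = ⊥-elim (irr ρ [] _ ρ∈R (root σ))
      head-in-cap (node Pf _) _ refl = Pf

  module _ (R : RS) (t : TermXA) (ρs : ℕ → Rule) where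

    SymbolSource : ℕ → Sym → Set
    SymbolSource k f = f occursIn t ⊎ Σ ℕ (λ i → (1 ≤ i) × (i ≤ k) × f occursIn rhs (ρs i))

    symbolSource-suc : ∀ {k f} → SymbolSource k f → SymbolSource (suc k) f
    symbolSource-suc (inj₁ f∈t) = inj₁ f∈t
    symbolSource-suc (inj₂ (i , 1≤i , i≤k , f∈r)) = inj₂ (i , 1≤i , m≤n⇒m≤1+n i≤k , f∈r)

    chain-cappedBy : ∀ {α n s ps} → Normalized R α t → IsChain R (α ⟨ t ⟩) n s ps ρs →
                     ∀ k → k ≤ n → CappedBy R (SymbolSource k) (s k)
    chain-cappedBy {α} α-normal (s₀≡αt , _) zero _ =
      subst (CappedBy R (SymbolSource 0)) (sym s₀≡αt)
            (cappedBy-⟨⟩ R α t inj₁ (λ x∈ → normal (α-normal _ x∈)))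
    chain-cappedBy {ps = ps} α-normal chain@(_ , steps) (suc k) k<n with steps k k<n
    ... | ρ∈R , step =
      cappedBy-step R ρ∈R (λ g∈ → inj₂ (suc k , s≤s z≤n , ≤-refl , g∈))
        (cappedBy-mono R symbolSource-suc (chain-cappedBy {ps = ps} α-normal chain k (<⇒≤ k<n))) step

lemmaC3 : (Sym : Set) (arity : Sym → ℕ) (X XA : Set) →
    let open Rewriting Sym arity X XA in
    (R : RS) (t : TermXA) (α : X ⊎ XA → GTerm) → Normalized R α t →
    (n : ℕ) (s : ℕ → GTerm) (ps : ℕ → Pos) (ρs : ℕ → Rule) →
    IsChain R (α ⟨ t ⟩) n s ps ρs →
    (k : ℕ) → 1 ≤ k → k ≤ n →
    (q : Pos) (v : GTerm) → s k at q is v → RedexPos R (s k) q →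
    (f : Sym) → headSym v ≡ just f →
    f occursIn t ⊎ Σ ℕ (λ i → (1 ≤ i) × (i ≤ k) × f occursIn rhs (ρs i))
lemmaC3 Sym arity X XA R t α α-normal n s ps ρs chain k _ k≤n q v sk∣q redex f head =
  redex-head-in-cap R (chain-cappedBy R t ρs {ps = ps} α-normal chain k k≤n) sk∣q redex head
  where open RewriteChainCaps Sym arity X XA
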